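{- Let $q$ be a prime power, $K,h\ge2$ integers, and $\mathcal{P}=\{P_1,\dots,P_N\}\subseteq\mathrm{PG}(K-1,q^h)$ a set of points. The following are equivalent: (a) the collection $\{\mathcal{F}_q(P_1),\dots,\mathcal{F}_q(P_N)\}$ of subspaces of $\mathrm{PG}(Kh-1,q)$ has the avoidance property; (b) $\{P_1,\dots,P_N\}$ is not contained in any hyperplane of $\mathrm{PG}(K-1,q^h)$, and there is no linear set $(L_V,\mathrm{wt}_V)$ of rank $Kh-2$ in $\mathrm{PG}(K-1,q^h)$ such that $\mathrm{wt}_V(P_i)=\dim_{\mathbb{F}_q}(V\cap P_i)\ge h-1$ for each $i\in[N]$.
   Context: Field reduction: identifying $\mathbb{F}_{q^h}^K$ with $\mathbb{F}_q^{Kh}$, a point $P=\langle v\rangle_{\mathbb{F}_{q^h}}$ is an $h$-dimensional $\mathbb{F}_q$-subspace, and $\mathcal{F}_q(P)$ is the corresponding $(h-1)$-dimensional projective subspace of $\mathrm{PG}(Kh-1,q)$. A collection of $(h-1)$-dimensional subspaces $U_1,\dots,U_N$ of $\mathrm{PG}(Kh-1,q)$ has the avoidance property if there is no codimension-$2$ subspace $\Lambda$ of $\mathrm{PG}(Kh-1,q)$ with $\dim(\Lambda\cap U_i)\ge h-2$ for all $i$ (projective dimensions). An $[n,K]_{q^h/q}$ system is an $n$-dimensional $\mathbb{F}_q$-subspace $V$ of $\mathbb{F}_{q^h}^K$ whose $\mathbb{F}_{q^h}$-span is $\mathbb{F}_{q^h}^K$. The linear set associated with $V$ is the pair $(L_V,\mathrm{wt}_V)$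 with $L_V=\{\langle v\rangle_{\mathbb{F}_{q^h}}:v\in V\setminus\{0\}\}\subseteq\mathrm{PG}(K-1,q^h)$ and $\mathrm{wt}_V(\langle u\rangle_{\mathbb{F}_{q^h}})=\dim_{\mathbb{F}_q}(V\cap\langle u\rangle_{\mathbb{F}_{q^h}})$; its rank is $\dim_{\mathbb{F}_q}V$. -}

module Defs where

open import Level using (Level; _⊔_; suc)
open import Data.Nat using (ℕ)
import Data.Nat as ℕ
open import Data.Nat.Primality using (Prime)
open import Data.Fin using (Fin)
open import Data.Product using (Σ; ∃; _×_; _,_)
open import Relation.Nullary using (¬_)
open import Relation.Binary.PropositionalEquality using (_≡_)
open import Algebra.Bundles using (CommutativeRing)
import Algebra.Definitions.RawMonoid as RM

record Field (c ℓ : Level) : Set (suc (c ⊔ ℓ)) where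
  field
    commutativeRing : CommutativeRing c ℓ
  open CommutativeRing commutativeRing public
  field
    0≉1     : ¬ (0# ≈ 1#)
    inverse : ∀ x → ¬ (x ≈ 0#) → Σ Carrier λ y → (x * y) ≈ 1#

-- A finite field extension L / F with |F| = q and [L : F] = h.
-- L is the field F_{q^h}; F ⊆ L is the subfield F_q, given as a predicate.

module Linear {c ℓ : Level} (L : Field c ℓ) where
  open Field L

  ∑ : (n : ℕ) → (Fin n → Carrier) → Carrier
  ∑ n f = RM.sum (CommutativeRing.+-rawMonoid commutativeRing) {n} f

  -- a scalar domain: either "all of L" or the subfield F
  Scalars : Set (suc (c ⊔ ℓ))
  Scalars = Carrier → Set (c ⊔ ℓ)

  Vect : ℕ → Set c
  Vect K = Fin K → Carrier

  _≋_ : ∀ {K} → Vect K → Vect K → Set ℓ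
  u ≋ v = ∀ j → u j ≈ v j

  zeroV : ∀ {K} → Vect K
  zeroV j = 0#

  _+V_ : ∀ {K} → Vect K → Vect K → Vect K
  (u +V v) j = u j + v j

  _·V_ : ∀ {K} → Carrier → Vect K → Vect K
  (a ·V v) j = a * v j

  lincomb : ∀ {K} (n : ℕ) → (Fin n → Carrier) → (Fin n → Vect K) → Vect K
  lincomb n a w j = ∑ n (λ i → a i * w i j)

  VSet : ℕ → Set (suc (c ⊔ ℓ))
  VSet K = Vect K → Set (c ⊔ ℓ)

  _∩_ : ∀ {K} → VSet K → VSet K → VSet K
  (A ∩ B) x = A x × B x

  record IsSubspace (S : Scalars) {K : ℕ} (U : VSet K) : Set (c ⊔ ℓ) where
    field
      respects : ∀ {x y} → x ≋ y → U x → U y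
      zero∈    : U zeroV
      +∈       : ∀ {x y} → U x → U y → U (x +V y)
      ·∈       : ∀ {a x} → S a → U x → U (a ·V x)

  Independent : (S : Scalars) {K : ℕ} (n : ℕ) → (Fin n → Vect K) → Set (c ⊔ ℓ)
  Independent S n w = (a : Fin n → Carrier) → (∀ i → S (a i)) →
                      lincomb n a w ≋ zeroV → ∀ i → a i ≈ 0#

  Spans : (S : Scalars) {K : ℕ} (n : ℕ) → (Fin n → Vect K) → VSet K → Set (c ⊔ ℓ)
  Spans S n w U = ∀ x → U x → Σ (Fin n → Carrier) λ a → (∀ i → S (a i)) × (x ≋ lincomb n a w)

  IsBasis : (S : Scalars) {K : ℕ} (n : ℕ) → (Fin n → Vect K) → VSet K → Set (c ⊔ ℓ)
  IsBasis S n w U = (∀ i → U (w i)) × Independent S n w × Spans S n w U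

  HasDim : (S : Scalars) {K : ℕ} → VSet K → ℕ → Set (c ⊔ ℓ)
  HasDim S {K} U n = Σ (Fin n → Vect K) λ w → IsBasis S n w U

  DimAtLeast : (S : Scalars) {K : ℕ} → VSet K → ℕ → Set (c ⊔ ℓ)
  DimAtLeast S {K} U d = Σ (Fin d → Vect K) λ w → (∀ i → U (w i)) × Independent S d w

  allL : Scalars
  allL x = Level.Lift (c ⊔ ℓ) Data.Unit.⊤
    where import Data.Unit

  -- projective points of PG(K-1, L): represented by nonzero vectors
  NonZeroV : ∀ {K} → Vect K → Set ℓ
  NonZeroV v = ¬ (v ≋ zeroV)

  -- the point ⟨v⟩_L as a subset of L^K (an F-subspace of F-dimension h)
  pt : ∀ {K} → Vect K → VSet K
  pt v x = Σ Carrier λ λ' → x ≋ (λ' ·V v)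

  SamePoint : ∀ {K} → Vect K → Vect K → Set (c ⊔ ℓ)
  SamePoint u v = pt v u

  LSpansAll : ∀ {K} → VSet K → Set (c ⊔ ℓ)
  LSpansAll {K} V = ∀ x → Σ ℕ λ m → Σ (Fin m → Vect K) λ w →
                    (∀ i → V (w i)) × Σ (Fin m → Carrier) λ a → x ≋ lincomb m a w

record FiniteExtension {c ℓ : Level} (L : Field c ℓ) (q h : ℕ) : Set (suc (c ⊔ ℓ)) where
  open Field L
  open Linear L
  field
    inF      : Carrier → Set (c ⊔ ℓ)
    inF-resp : ∀ {x y} → x ≈ y → inF x → inF y
    inF-0    : inF 0#
    inF-1    : inF 1#
    inF-+    : ∀ {x y} → inF x → inF y → inF (x + y)
    inF-neg  : ∀ {x} → inF x → inF (- x)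
    inF-*    : ∀ {x y} → inF x → inF y → inF (x * y)
    inF-inv  : ∀ {x y} → inF x → (x * y) ≈ 1# → inF y
    -- |F| = q, via an enumeration Fin q → F that is injective and onto F (up to ≈)
    enum     : Fin q → Carrier
    enum-in  : ∀ i → inF (enum i)
    enum-inj : ∀ i j → enum i ≈ enum j → i ≡ j
    enum-sur : ∀ x → inF x → Σ (Fin q) λ i → enum i ≈ x
    -- [L : F] = h : L has an F-basis of size h
    basis       : Fin h → Carrier
    basis-indep : (a : Fin h → Carrier) → (∀ i → inF (a i)) →
                  ∑ h (λ i → a i * basis i) ≈ 0# → ∀ i → a i ≈ 0#
    basis-span  : ∀ x → Σ (Fin h → Carrier) λ a → (∀ i → inF (a i)) ×
                  (x ≈ ∑ h (λ i → a i * basis i))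

IsPrimePower : ℕ → Set
IsPrimePower q = Σ ℕ λ p → Σ ℕ λ k → Prime p × k ℕ.≥ 1 × q ≡ p ℕ.^ k

module Theorem {c ℓ : Level} {L : Field c ℓ} {q h : ℕ} (E : FiniteExtension L q h) where
  open Field L using (Carrier)
  open Linear L
  open FiniteExtension E using (inF)

  -- Field reduction is realised by regarding L^K itself as the F-vector space
  -- F^{Kh}; F_q(P_i) is then the h-dim F-subspace  pt (P i) = ⟨P i⟩_L.
  -- Avoidance property: there is no F-subspace Λ of F-dimension Kh-2
  -- (projective codimension 2) with dim_F(Λ ∩ F_q(P_i)) ≥ h-1
  -- (projective dimension ≥ h-2) for all i.
  AvoidanceProperty : ∀ {K N} → (Fin N → Vect K) → Set (suc (c ⊔ ℓ))
  AvoidanceProperty {K} P =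
    ¬ (Σ (VSet K) λ Λ → IsSubspace inF Λ × HasDim inF Λ (K ℕ.* h ℕ.∸ 2) ×
         (∀ i → DimAtLeast inF (Λ ∩ pt (P i)) (h ℕ.∸ 1)))

  -- the points lie in a common hyperplane of PG(K-1, q^h)
  -- (an L-subspace of L-dimension K-1)
  InSomeHyperplane : ∀ {K N} → (Fin N → Vect K) → Set (suc (c ⊔ ℓ))
  InSomeHyperplane {K} P =
    Σ (VSet K) λ H → IsSubspace allL H × HasDim allL H (K ℕ.∸ 1) × (∀ i → H (P i))

  -- there is an [Kh-2, K]_{q^h/q} system V (F-subspace of F-dimension Kh-2 whose
  -- L-span is L^K), i.e. a linear set L_V of rank Kh-2, with
  -- wt_V(P_i) = dim_F(V ∩ ⟨P i⟩_L) ≥ h-1 for all i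
  BadLinearSet : ∀ {K N} → (Fin N → Vect K) → Set (suc (c ⊔ ℓ))
  BadLinearSet {K} P =
    Σ (VSet K) λ V → IsSubspace inF V × HasDim inF V (K ℕ.* h ℕ.∸ 2) × LSpansAll V ×
      (∀ i → DimAtLeast inF (V ∩ pt (P i)) (h ℕ.∸ 1))

-- Regard L^K, L = F_{q^h}, as F^{Kh}, so that F_q(P) is the point ⟨P⟩_L itself. If Λ is an
-- F-subspace of dimension Kh-2 meeting every ⟨P_i⟩_L in dimension at least h-1 ≥ 1, then Λ
-- contains a nonzero multiple of every P_i. Either the L-span of Λ is all of L^K, and Λ is a
-- linear set as in (b), or it lies in a hyperplane, which then contains every P_i.
-- Conversely, if all P_i lie in a hyperplane ⟨w_1, …, w_{K-1}⟩_L and u is outside it, then for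
-- an F-basis b_0, …, b_{h-1} of L the F-span of the vectors b_j w_k and b_2 u, …, b_{h-1} u has
-- dimension Kh-2 and contains b_1 P_i, …, b_{h-1} P_i.
-- All dimension counts reduce to the Steinitz bound, and every case distinction is decidable
-- because L is finite.
module Submission where

open import Defs
open import Level using (Level; lift; _⊔_)
open import Data.Nat using (ℕ; _≥_; zero; suc; _≤_; _<_; z≤n; s≤s)
import Data.Nat as ℕ
import Data.Nat.Properties as ℕP
open import Data.Fin using (Fin; zero; suc; _↑ˡ_; _↑ʳ_; punchIn; splitAt; join)
import Data.Fin.Properties as FP
open import Data.Product using (_×_; Σ; _,_; proj₁; proj₂)
open import Data.Sum using (_⊎_; inj₁; inj₂; [_,_])
open import Data.Empty using (⊥-elim)
open import Data.Unit using (tt)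
open import Data.Vec.Functional using (Vector; _∷_; _++_; insertAt)
open import Data.Vec.Functional.Properties using (lookup-++ˡ; lookup-++ʳ; insertAt-lookup; insertAt-punchIn)
open import Function using (_∘_)
open import Function.Bundles using (_⇔_; mk⇔)
open import Relation.Nullary using (¬_; Dec; yes; no; _×-dec_)
open import Relation.Binary using (Decidable)
open import Relation.Binary.PropositionalEquality as ≡ using (_≡_)

Searchable : ∀ {a e} (A : Set a) (_~_ : A → A → Set e) (p : Level) → Set (a ⊔ e ⊔ Level.suc p)
Searchable A _~_ p = (P : A → Set p) → (∀ {x y} → x ~ y → P x → P y) → (∀ x → Dec (P x)) → Dec (Σ A P)

search-Fin : ∀ {n p} → Searchable (Fin n) _≡_ p
search-Fin P _ P? = FP.any? P?

search-Vector : ∀ {a e p} {A : Set a} {_~_ : A → A → Set e} → (∀ {x} → x ~ x) →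
                Searchable A _~_ (a ⊔ p) → ∀ r → Searchable (Vector A r) (λ f g → ∀ i → f i ~ g i) (a ⊔ p)
search-Vector rfl search-A zero P resp P? with P? (λ ())
... | yes p = yes ((λ ()) , p)
... | no ¬p = no λ { (f , p) → ¬p (resp (λ ()) p) }
search-Vector {p = p} {A = A} rfl search-A (suc r) P resp P? with search-A Extends Extends-resp Extends?
  where
    Extends : A → Set _
    Extends x = Σ (Vector A r) λ t → P (x ∷ t)
    Extends-resp : ∀ {x y} → _ → Extends x → Extends y
    Extends-resp x~y (t , p) = t , resp (λ { zero → x~y ; (suc i) → rfl }) p
    Extends? : ∀ x → Dec (Extends x)
    Extends? x = search-Vector {p = p} rfl search-A r (λ t → P (x ∷ t))
                   (λ t~t′ → resp λ { zero → rfl ; (suc i) → t~t′ i }) (λ t → P? (x ∷ t))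
... | yes (x , t , p) = yes ((x ∷ t) , p)
... | no ¬p = no λ { (f , p) → ¬p (f zero , f ∘ suc , resp (λ { zero → rfl ; (suc i) → rfl }) p) }

search-surjection : ∀ {a b e e′ p} {A : Set a} {B : Set b} {_~A_ : A → A → Set e} {_~B_ : B → B → Set e′} →
                    (∀ {x y} → x ~A y → y ~A x) → (g : B → A) → (∀ {x y} → x ~B y → g x ~A g y) →
                    (∀ x → Σ B λ y → g y ~A x) → Searchable B _~B_ p → Searchable A _~A_ p
search-surjection sym g g-resp g-onto search-B P resp P? with search-B (P ∘ g) (resp ∘ g-resp) (P? ∘ g)
... | yes (y , p) = yes (g y , p)
... | no ¬p = no λ { (x , p) → ¬p (proj₁ (g-onto x) , resp (sym (proj₂ (g-onto x))) p) }

splitAt-elim : ∀ {p} m n (Q : Fin (m ℕ.+ n) → Set p) →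
               (∀ i → Q (i ↑ˡ n)) → (∀ j → Q (m ↑ʳ j)) → ∀ t → Q t
splitAt-elim m n Q Qˡ Qʳ t = ≡.subst Q (FP.join-splitAt m n t) (Q-join (splitAt m t))
  where
    Q-join : ∀ s → Q (join m n s)
    Q-join (inj₁ i) = Qˡ i
    Q-join (inj₂ j) = Qʳ j

insertAt-∀ : ∀ {a p} {A : Set a} (Q : A → Set p) {n} (xs : Vector A n) i {x} →
             Q x → (∀ j → Q (xs j)) → ∀ k → Q (insertAt xs i x k)
insertAt-∀ Q xs zero Qx Qxs zero = Qx
insertAt-∀ Q xs zero Qx Qxs (suc k) = Qxs k
insertAt-∀ Q {suc n} xs (suc i) Qx Qxs zero = Qxs zero
insertAt-∀ Q {suc n} xs (suc i) Qx Qxs (suc k) = insertAt-∀ Q (xs ∘ suc) i Qx (Qxs ∘ suc) k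

module LinearCombination {c ℓ} (L : Field c ℓ) where
  open Field L hiding (zero)
  open Linear L
  open import Algebra.Properties.Semiring.Sum semiring
    using (sum-cong-≋; sum-replicate-zero; ∑-distrib-+; *-distribˡ-sum; *-distribʳ-sum)

  ∑-cong : ∀ n {f g : Fin n → Carrier} → (∀ i → f i ≈ g i) → ∑ n f ≈ ∑ n g
  ∑-cong n = sum-cong-≋

  ∑-zero : ∀ n {f : Fin n → Carrier} → (∀ i → f i ≈ 0#) → ∑ n f ≈ 0#
  ∑-zero n f≈0 = trans (sum-cong-≋ f≈0) (sum-replicate-zero n)

  ∑-++ : ∀ m n (f : Fin (m ℕ.+ n) → Carrier) → ∑ (m ℕ.+ n) f ≈ ∑ m (f ∘ (_↑ˡ n)) + ∑ n (f ∘ (m ↑ʳ_))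
  ∑-++ zero n f = sym (+-identityˡ _)
  ∑-++ (suc m) n f = trans (+-congˡ (∑-++ m n (f ∘ suc))) (sym (+-assoc _ _ _))

  δ : ∀ {n} → Fin n → Fin n → Carrier
  δ zero zero = 1#
  δ zero (suc _) = 0#
  δ (suc _) zero = 0#
  δ (suc i) (suc j) = δ i j

  ∑-δˡ : ∀ n i (f : Fin n → Carrier) → ∑ n (λ k → δ i k * f k) ≈ f i
  ∑-δˡ (suc n) zero f = trans (+-cong (*-identityˡ _) (∑-zero n (λ k → zeroˡ _))) (+-identityʳ _)
  ∑-δˡ (suc n) (suc i) f = trans (+-cong (zeroˡ _) (∑-δˡ n i (f ∘ suc))) (+-identityˡ _)

  ∑-δʳ : ∀ n i (f : Fin n → Carrier) → ∑ n (λ k → f k * δ k i) ≈ f i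
  ∑-δʳ (suc n) zero f = trans (+-cong (*-identityʳ _) (∑-zero n (λ k → zeroʳ _))) (+-identityʳ _)
  ∑-δʳ (suc n) (suc i) f = trans (+-cong (zeroʳ _) (∑-δʳ n i (f ∘ suc))) (+-identityˡ _)

  module _ {K : ℕ} where
    lincomb-cong : ∀ n {a a′ : Fin n → Carrier} {w w′ : Fin n → Vect K} →
                   (∀ i → a i ≈ a′ i) → (∀ i → w i ≋ w′ i) → lincomb n a w ≋ lincomb n a′ w′
    lincomb-cong n a≈ w≋ j = ∑-cong n (λ i → *-cong (a≈ i) (w≋ i j))

    lincomb-zero : ∀ n (w : Fin n → Vect K) → lincomb n (λ _ → 0#) w ≋ zeroV
    lincomb-zero n w j = ∑-zero n (λ i → zeroˡ _)

    lincomb-+ : ∀ n (a b : Fin n → Carrier) (w : Fin n → Vect K) →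
                lincomb n (λ i → a i + b i) w ≋ (lincomb n a w +V lincomb n b w)
    lincomb-+ n a b w j = trans (∑-cong n (λ i → distribʳ _ _ _)) (∑-distrib-+ (λ i → a i * w i j) (λ i → b i * w i j))

    lincomb-· : ∀ n x (a : Fin n → Carrier) (w : Fin n → Vect K) →
                lincomb n (λ i → x * a i) w ≋ (x ·V lincomb n a w)
    lincomb-· n x a w j = trans (∑-cong n (λ i → *-assoc _ _ _)) (sym (*-distribˡ-sum x (λ i → a i * w i j)))

    lincomb-δ : ∀ n i (w : Fin n → Vect K) → lincomb n (δ i) w ≋ w i
    lincomb-δ n i w j = ∑-δˡ n i (λ k → w k j)

    lincomb-scaled : ∀ n (a b : Fin n → Carrier) (x : Vect K) →
                     lincomb n a (λ i → b i ·V x) ≋ (∑ n (λ i → a i * b i) ·V x)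
    lincomb-scaled n a b x j = trans (∑-cong n (λ i → sym (*-assoc _ _ _))) (sym (*-distribʳ-sum (x j) (λ i → a i * b i)))

    lincomb-++ : ∀ m n (a : Fin (m ℕ.+ n) → Carrier) (f : Fin m → Vect K) (g : Fin n → Vect K) →
                 lincomb (m ℕ.+ n) a (f ++ g) ≋ (lincomb m (a ∘ (_↑ˡ n)) f +V lincomb n (a ∘ (m ↑ʳ_)) g)
    lincomb-++ m n a f g j = trans (∑-++ m n (λ t → a t * (f ++ g) t j))
      (+-cong (∑-cong m (λ i → *-congˡ (reflexive (≡.cong (λ v → v j) (lookup-++ˡ f g i)))))
              (∑-cong n (λ i → *-congˡ (reflexive (≡.cong (λ v → v j) (lookup-++ʳ f g i))))))

  record IsSubfield (S : Scalars) : Set (c ⊔ ℓ) where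
    field
      S-0 : S 0#
      S-1 : S 1#
      S-+ : ∀ {x y} → S x → S y → S (x + y)
      S-neg : ∀ {x} → S x → S (- x)
      S-* : ∀ {x y} → S x → S y → S (x * y)
      S-inv : ∀ {x y} → S x → x * y ≈ 1# → S y

  allL-isSubfield : IsSubfield allL
  allL-isSubfield = record
    { S-0 = lift tt ; S-1 = lift tt ; S-+ = λ _ _ → lift tt
    ; S-neg = λ _ → lift tt ; S-* = λ _ _ → lift tt ; S-inv = λ _ _ → lift tt }

module LinearAlgebra {c ℓ} (L : Field c ℓ) (_≟_ : Decidable (Field._≈_ L)) where
  open Field L hiding (zero)
  open Linear L
  open LinearCombination L
  open import Algebra.Properties.Ring ring using (-‿distribˡ-*; -1*x≈-x)
  open import Algebra.Properties.Group +-group using (inverseˡ-unique)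
  open import Algebra.Properties.Semiring.Sum semiring using (∑-distrib-+; *-distribʳ-sum; sum-remove)
  open import Algebra.Properties.CommutativeSemigroup +-commutativeSemigroup using (interchange)
  open import Relation.Binary.Reasoning.Setoid setoid

  +-cancel-neg : ∀ x y z → (x + y) + (- x + z) ≈ y + z
  +-cancel-neg x y z = begin
    (x + y) + (- x + z)   ≈⟨ interchange x y (- x) z ⟩
    (x + - x) + (y + z)   ≈⟨ +-congʳ (-‿inverseʳ x) ⟩
    0# + (y + z)          ≈⟨ +-identityˡ _ ⟩
    y + z                 ∎

  inverse-cancelˡ : ∀ {a} (a≉0 : ¬ a ≈ 0#) x → proj₁ (inverse a a≉0) * (a * x) ≈ x
  inverse-cancelˡ {a} a≉0 x = begin
    a⁻¹ * (a * x) ≈⟨ sym (*-assoc _ _ _) ⟩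
    (a⁻¹ * a) * x ≈⟨ *-congʳ (trans (*-comm _ _) (proj₂ (inverse a a≉0))) ⟩
    1# * x        ≈⟨ *-identityˡ x ⟩
    x             ∎
    where a⁻¹ = proj₁ (inverse a a≉0)

  scale≋0⇒≈0 : ∀ {K a} {v : Vect K} → NonZeroV v → (a ·V v) ≋ zeroV → a ≈ 0#
  scale≋0⇒≈0 {a = a} {v} v≉0 av≋0 with a ≟ 0#
  ... | yes a≈0 = a≈0
  ... | no a≉0 = ⊥-elim (v≉0 λ j → trans (sym (inverse-cancelˡ a≉0 (v j))) (trans (*-congˡ (av≋0 j)) (zeroʳ _)))

  module OverSubfield (S : Scalars) (S-isSubfield : IsSubfield S) where
    open IsSubfield S-isSubfield

    S-δ : ∀ {n} (i j : Fin n) → S (δ i j)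
    S-δ zero zero = S-1
    S-δ zero (suc _) = S-0
    S-δ (suc _) zero = S-0
    S-δ (suc i) (suc j) = S-δ i j

    S-∑ : ∀ n {f : Fin n → Carrier} → (∀ i → S (f i)) → S (∑ n f)
    S-∑ zero Sf = S-0
    S-∑ (suc n) Sf = S-+ (Sf zero) (S-∑ n (Sf ∘ suc))

    Span : ∀ {K r} → (Fin r → Vect K) → VSet K
    Span {r = r} w x = Σ (Fin r → Carrier) λ a → (∀ i → S (a i)) × (x ≋ lincomb r a w)

    Span-isSubspace : ∀ {K r} (w : Fin r → Vect K) → IsSubspace S (Span w)
    Span-isSubspace {r = r} w = record
      { respects = λ { x≋y (a , Sa , x≋) → a , Sa , λ j → trans (sym (x≋y j)) (x≋ j) }
      ; zero∈ = (λ _ → 0#) , (λ _ → S-0) , (λ j → sym (lincomb-zero r w j))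
      ; +∈ = λ { (a , Sa , x≋) (b , Sb , y≋) → (λ i → a i + b i) , (λ i → S-+ (Sa i) (Sb i))
               , λ j → trans (+-cong (x≋ j) (y≋ j)) (sym (lincomb-+ r a b w j)) }
      ; ·∈ = λ { {x} Sx (a , Sa , y≋) → (λ i → x * a i) , (λ i → S-* Sx (Sa i))
               , λ j → trans (*-congˡ (y≋ j)) (sym (lincomb-· r x a w j)) } }

    lincomb∈ : ∀ {K} {U : VSet K} → IsSubspace S U → ∀ n {a : Fin n → Carrier} {v : Fin n → Vect K} →
               (∀ t → S (a t)) → (∀ t → U (v t)) → U (lincomb n a v)
    lincomb∈ U-sub zero Sa v∈U = respects (λ j → refl) zero∈
      where open IsSubspace U-sub
    lincomb∈ U-sub (suc n) Sa v∈U =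
      respects (λ j → refl) (+∈ (·∈ (Sa zero) (v∈U zero)) (lincomb∈ U-sub n (Sa ∘ suc) (v∈U ∘ suc)))
      where open IsSubspace U-sub

    ∈-unscale : ∀ {K} {U : VSet K} → IsSubspace S U → ∀ {a x} → S a → ¬ a ≈ 0# → U (a ·V x) → U x
    ∈-unscale U-sub {a} {x} Sa a≉0 ax∈U =
      IsSubspace.respects U-sub (λ j → inverse-cancelˡ a≉0 (x j))
        (IsSubspace.·∈ U-sub (S-inv Sa (proj₂ (inverse a a≉0))) ax∈U)

    Span-member : ∀ {K r} (w : Fin r → Vect K) i → Span w (w i)
    Span-member {r = r} w i = δ i , S-δ i , λ j → sym (lincomb-δ r i w j)

    Span-mono : ∀ {K r n} {g : Fin r → Vect K} {f : Fin n → Vect K} → (∀ t → Span g (f t)) →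
                ∀ {y} → Span f y → Span g y
    Span-mono {n = n} {g} f∈ (a , Sa , y≋) =
      IsSubspace.respects (Span-isSubspace g) (λ j → sym (y≋ j)) (lincomb∈ (Span-isSubspace g) n Sa f∈)

    Span-++ˡ : ∀ {K a b} (f : Fin a → Vect K) (g : Fin b → Vect K) i → Span (f ++ g) (f i)
    Span-++ˡ f g i = IsSubspace.respects (Span-isSubspace (f ++ g))
      (λ j → reflexive (≡.cong (λ v → v j) (lookup-++ˡ f g i))) (Span-member (f ++ g) (i ↑ˡ _))

    Span-++ʳ : ∀ {K a b} (f : Fin a → Vect K) (g : Fin b → Vect K) j → Span (f ++ g) (g j)
    Span-++ʳ {a = a} f g i = IsSubspace.respects (Span-isSubspace (f ++ g))
      (λ j → reflexive (≡.cong (λ v → v j) (lookup-++ʳ f g i))) (Span-member (f ++ g) (a ↑ʳ i))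

    Span-cons : ∀ {K r} (w : Fin r → Vect K) x {y} → Span w y → Span (x ∷ w) y
    Span-cons w x (a , Sa , y≋) = (0# ∷ a) , (λ { zero → S-0 ; (suc i) → Sa i })
                                , λ j → trans (y≋ j) (sym (trans (+-congʳ (zeroˡ _)) (+-identityˡ _)))

    Span-dropHead : ∀ {K m} (u : Fin (suc m) → Vect K) {x} (x∈ : Span u x) → proj₁ x∈ zero ≈ 0# → Span (u ∘ suc) x
    Span-dropHead u (a , Sa , x≋) a₀≈0 =
      a ∘ suc , Sa ∘ suc , λ j → trans (x≋ j) (trans (+-congʳ (trans (*-congʳ a₀≈0) (zeroˡ _))) (+-identityˡ _))

    Span-eliminateHead : ∀ {K m} (u : Fin (suc m) → Vect K) {x y} (x∈ : Span u x) (y∈ : Span u y) {s} →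
                         S s → s * proj₁ y∈ zero ≈ proj₁ x∈ zero → Span (u ∘ suc) (x +V ((- s) ·V y))
    Span-eliminateHead {m = m} u {x} {y} (a , Sa , x≋) (b , Sb , y≋) {s} Ss sb₀≈a₀ =
      (λ k → a (suc k) + (- s) * b (suc k)) , (λ k → S-+ (Sa (suc k)) (S-* (S-neg Ss) (Sb (suc k)))) , λ j → begin
        x j + (- s) * y j
          ≈⟨ +-cong (x≋ j) (*-congˡ (y≋ j)) ⟩
        (a zero * u zero j + A j) + (- s) * (b zero * u zero j + B j)
          ≈⟨ +-congˡ (distribˡ _ _ _) ⟩
        (a zero * u zero j + A j) + ((- s) * (b zero * u zero j) + (- s) * B j)
          ≈⟨ +-congˡ (+-congʳ (trans (sym (-‿distribˡ-* _ _))
                                     (-‿cong (trans (sym (*-assoc _ _ _)) (*-congʳ sb₀≈a₀))))) ⟩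
        (a zero * u zero j + A j) + (- (a zero * u zero j) + (- s) * B j)
          ≈⟨ +-cancel-neg _ _ _ ⟩
        A j + (- s) * B j
          ≈⟨ +-congˡ (sym (lincomb-· m (- s) (b ∘ suc) (u ∘ suc) j)) ⟩
        A j + lincomb m (λ k → (- s) * b (suc k)) (u ∘ suc) j
          ≈⟨ sym (lincomb-+ m (a ∘ suc) _ (u ∘ suc) j) ⟩
        lincomb m (λ k → a (suc k) + (- s) * b (suc k)) (u ∘ suc) j ∎
      where
        A B : Vect _
        A = lincomb m (a ∘ suc) (u ∘ suc)
        B = lincomb m (b ∘ suc) (u ∘ suc)

    independent⇒head-nonzero : ∀ {K n} (v : Fin (suc n) → Vect K) → Independent S (suc n) v → NonZeroV (v zero)
    independent⇒head-nonzero {n = n} v ind v₀≋0 =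
      0≉1 (sym (ind (δ zero) (S-δ zero) (λ j → trans (lincomb-δ (suc n) zero v j) (v₀≋0 j)) zero))

    independent-tail : ∀ {K n} (v : Fin (suc n) → Vect K) → Independent S (suc n) v → Independent S n (v ∘ suc)
    independent-tail v ind a Sa a·v≋0 i =
      ind (0# ∷ a) (λ { zero → S-0 ; (suc i) → Sa i })
          (λ j → trans (+-congʳ (zeroˡ _)) (trans (+-identityˡ _) (a·v≋0 j))) (suc i)

    cons-independent : ∀ {K r} (w : Fin r → Vect K) {x} → ¬ Span w x → Independent S r w → Independent S (suc r) (x ∷ w)
    cons-independent {r = r} w {x} x∉ ind a Sa a·xw≋0 with a zero ≟ 0#
    ... | yes a₀≈0 = λ { zero → a₀≈0 ; (suc i) → ind (a ∘ suc) (Sa ∘ suc) tail≋0 i }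
      where
        tail≋0 : lincomb r (a ∘ suc) w ≋ zeroV
        tail≋0 j = trans (sym (trans (+-congʳ (trans (*-congʳ a₀≈0) (zeroˡ _))) (+-identityˡ _))) (a·xw≋0 j)
    ... | no a₀≉0 = ⊥-elim (x∉ (∈-unscale (Span-isSubspace w) (Sa zero) a₀≉0 a₀x∈))
      where
        a₀x∈ : Span w (a zero ·V x)
        a₀x∈ = (λ i → - 1# * a (suc i)) , (λ i → S-* (S-neg S-1) (Sa (suc i))) , λ j → begin
          a zero * x j                          ≈⟨ inverseˡ-unique _ _ (a·xw≋0 j) ⟩
          - lincomb r (a ∘ suc) w j             ≈⟨ sym (-1*x≈-x _) ⟩
          - 1# * lincomb r (a ∘ suc) w j        ≈⟨ sym (lincomb-· r (- 1#) (a ∘ suc) w j) ⟩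
          lincomb r (λ i → - 1# * a (suc i)) w j ∎

    sweep : ∀ {K n} → Fin (suc n) → (Fin n → Carrier) → (Fin (suc n) → Vect K) → Fin n → Vect K
    sweep p s v i = v (punchIn p i) +V ((- s i) ·V v p)

    -- A dependence a among the sweep extends to the dependence of v that puts Σ a_i (-s_i) at p.
    sweep-independent : ∀ {K n} p {s : Fin n → Carrier} → (∀ i → S (s i)) → (v : Fin (suc n) → Vect K) →
                        Independent S (suc n) v → Independent S n (sweep p s v)
    sweep-independent {n = n} p {s} Ss v ind a Sa a·sweep≋0 i =
      trans (sym (reflexive (insertAt-punchIn a p σ i))) (ind A SA A·v≋0 (punchIn p i))
      where
        π = punchIn p
        σ = ∑ n (λ i → a i * - s i)
        A = insertAt a p σ
        SA : ∀ k → S (A k)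
        SA = insertAt-∀ S a p (S-∑ n (λ i → S-* (Sa i) (S-neg (Ss i)))) Sa
        A·v≋0 : lincomb (suc n) A v ≋ zeroV
        A·v≋0 j = begin
          lincomb (suc n) A v j
            ≈⟨ sum-remove {i = p} (λ k → A k * v k j) ⟩
          A p * v p j + ∑ n (λ i → A (π i) * v (π i) j)
            ≈⟨ +-cong (*-congʳ (reflexive (insertAt-lookup a p σ)))
                      (∑-cong n (λ i → *-congʳ (reflexive (insertAt-punchIn a p σ i)))) ⟩
          σ * v p j + ∑ n (λ i → a i * v (π i) j)
            ≈⟨ +-comm _ _ ⟩
          ∑ n (λ i → a i * v (π i) j) + σ * v p j
            ≈⟨ +-congˡ (*-distribʳ-sum (v p j) (λ i → a i * - s i)) ⟩
          ∑ n (λ i → a i * v (π i) j) + ∑ n (λ i → (a i * - s i) * v p j)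
            ≈⟨ sym (∑-distrib-+ (λ i → a i * v (π i) j) (λ i → (a i * - s i) * v p j)) ⟩
          ∑ n (λ i → a i * v (π i) j + (a i * - s i) * v p j)
            ≈⟨ ∑-cong n (λ i → trans (+-congˡ (*-assoc _ _ _)) (sym (distribˡ _ _ _))) ⟩
          lincomb n a (sweep p s v) j
            ≈⟨ a·sweep≋0 j ⟩
          0# ∎

    -- Steinitz: if no v_t has a coordinate along u_0, drop u_0; otherwise sweeping a v_p with
    -- nonzero u_0-coordinate out of the others leaves n independent vectors in ⟨u_1, …⟩.
    independent-in-span⇒≤ : ∀ {K m n} (u : Fin m → Vect K) (v : Fin n → Vect K) →
                            (∀ t → Span u (v t)) → Independent S n v → n ≤ m
    independent-in-span⇒≤ {n = zero} u v v∈ ind = z≤n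
    independent-in-span⇒≤ {m = zero} {suc n} u v v∈ ind =
      ⊥-elim (independent⇒head-nonzero v ind (proj₂ (proj₂ (v∈ zero))))
    independent-in-span⇒≤ {m = suc m} {suc n} u v v∈ ind with FP.all? (λ t → proj₁ (v∈ t) zero ≟ 0#)
    ... | yes heads≈0 =
      ℕP.m≤n⇒m≤1+n (independent-in-span⇒≤ (u ∘ suc) v (λ t → Span-dropHead u (v∈ t) (heads≈0 t)) ind)
    ... | no ¬heads≈0 with FP.¬∀⟶∃¬ _ _ (λ t → proj₁ (v∈ t) zero ≟ 0#) ¬heads≈0
    ... | p , cₚ≉0 = s≤s (independent-in-span⇒≤ (u ∘ suc) (sweep p s v) sweep∈ (sweep-independent p Ss v ind))
      where
        c₀ : Fin (suc n) → Carrier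
        c₀ t = proj₁ (v∈ t) zero
        cₚ⁻¹ = proj₁ (inverse (c₀ p) cₚ≉0)
        s : Fin n → Carrier
        s i = c₀ (punchIn p i) * cₚ⁻¹
        Ss : ∀ i → S (s i)
        Ss i = S-* (proj₁ (proj₂ (v∈ _)) zero) (S-inv (proj₁ (proj₂ (v∈ p)) zero) (proj₂ (inverse (c₀ p) cₚ≉0)))
        sweep∈ : ∀ i → Span (u ∘ suc) (sweep p s v i)
        sweep∈ i = Span-eliminateHead u (v∈ (punchIn p i)) (v∈ p) (Ss i)
          (trans (*-assoc _ _ _) (trans (*-congˡ (trans (*-comm _ _) (proj₂ (inverse (c₀ p) cₚ≉0)))) (*-identityʳ _)))

  pt∩nonzero⇒∈ : ∀ {K} {U : VSet K} → IsSubspace allL U → ∀ {v y} → pt v y → NonZeroV y → U y → U v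
  pt∩nonzero⇒∈ U-sub {v} {y} (μ , y≋μv) y≉0 y∈U with μ ≟ 0#
  ... | yes μ≈0 = ⊥-elim (y≉0 λ j → trans (y≋μv j) (trans (*-congʳ μ≈0) (zeroˡ _)))
  ... | no μ≉0 = OverSubfield.∈-unscale allL allL-isSubfield U-sub (lift tt) μ≉0
                   (IsSubspace.respects U-sub y≋μv y∈U)

module FiniteExtensionFacts {c ℓ} {L : Field c ℓ} {q h : ℕ} (E : FiniteExtension L q h) where
  open Field L hiding (zero)
  open Linear L
  open FiniteExtension E
  open LinearCombination L
  open import Algebra.Properties.Group +-group using (x∙y⁻¹≈ε⇒x≈y; x≈y⇒x∙y⁻¹≈ε)

  F-≟0 : ∀ {z} → inF z → Dec (z ≈ 0#)
  F-≟0 {z} z∈F with enum-sur z z∈F | enum-sur 0# inF-0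
  ... | i , enumᵢ≈z | i₀ , enumᵢ₀≈0 with i FP.≟ i₀
  ... | yes ≡.refl = yes (trans (sym enumᵢ≈z) enumᵢ₀≈0)
  ... | no i≢i₀ = no λ z≈0 → i≢i₀ (enum-inj i i₀ (trans enumᵢ≈z (trans z≈0 (sym enumᵢ₀≈0))))

  _≟_ : Decidable _≈_
  x ≟ y with basis-span (x - y)
  ... | a , a∈F , x-y≈ with FP.all? (λ i → F-≟0 (a∈F i))
  ... | yes a≈0 = yes (x∙y⁻¹≈ε⇒x≈y x y (trans x-y≈ (∑-zero h λ i → trans (*-congʳ (a≈0 i)) (zeroˡ _))))
  ... | no ¬a≈0 = no λ x≈y → ¬a≈0 (basis-indep a a∈F (trans (sym x-y≈) (x≈y⇒x∙y⁻¹≈ε x≈y)))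

  open LinearAlgebra L _≟_

  F-isSubfield : IsSubfield inF
  F-isSubfield = record
    { S-0 = inF-0 ; S-1 = inF-1 ; S-+ = inF-+ ; S-neg = inF-neg
    ; S-* = inF-* ; S-inv = inF-inv }

  module SF = OverSubfield inF F-isSubfield
  module SL = OverSubfield allL allL-isSubfield

  search-L : Searchable Carrier _≈_ (c ⊔ ℓ)
  search-L = search-surjection sym fromCoordinates fromCoordinates-cong onto
                               (search-Vector {p = c ⊔ ℓ} ≡.refl search-Fin h)
    where
      fromCoordinates : (Fin h → Fin q) → Carrier
      fromCoordinates σ = ∑ h (λ i → enum (σ i) * basis i)
      fromCoordinates-cong : ∀ {σ τ} → (∀ i → σ i ≡ τ i) → fromCoordinates σ ≈ fromCoordinates τ
      fromCoordinates-cong σ≡τ = ∑-cong h (λ i → *-congʳ (reflexive (≡.cong enum (σ≡τ i))))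
      onto : ∀ x → Σ (Fin h → Fin q) λ σ → fromCoordinates σ ≈ x
      onto x with basis-span x
      ... | a , a∈F , x≈ = (λ i → proj₁ (enum-sur (a i) (a∈F i)))
                         , trans (∑-cong h (λ i → *-congʳ (proj₂ (enum-sur (a i) (a∈F i))))) (sym x≈)

  Span? : ∀ {K r} (w : Fin r → Vect K) x → Dec (SL.Span w x)
  Span? {r = r} w x = search-Vector {p = ℓ} refl search-L r _
    (λ a≈b (_ , x≋) → (λ _ → lift tt) , λ j → trans (x≋ j) (lincomb-cong r {w = w} a≈b (λ _ _ → refl) j))
    (λ a → yes (λ _ → lift tt) ×-dec FP.all? (λ j → x j ≟ lincomb r a w j))

  e : ∀ {K} → Fin K → Vect K
  e = δ

  e-independent : ∀ K → Independent allL K e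
  e-independent K a _ a·e≋0 i = trans (sym (∑-δʳ K i a)) (a·e≋0 i)

  Span-e : ∀ {K} (v : Vect K) → SL.Span e v
  Span-e {K} v = v , (λ _ → lift tt) , λ j → sym (∑-δʳ K j v)

  independent⇒≤dim : ∀ {K r} (w : Fin r → Vect K) → Independent allL r w → r ≤ K
  independent⇒≤dim w = SL.independent-in-span⇒≤ e w (Span-e ∘ w)

  ∃e∉Span : ∀ {K m} (w : Fin m → Vect K) → m < K → Σ (Fin K) λ k → ¬ SL.Span w (e k)
  ∃e∉Span {K} w m<K = FP.¬∀⟶∃¬ K _ (Span? w ∘ e)
    λ e∈ → ℕP.<⇒≱ m<K (SL.independent-in-span⇒≤ w e e∈ (e-independent K))

  basisOfSpan : ∀ {K M} (x : Fin M → Vect K) (U : VSet K) → (∀ t → U (x t)) →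
                Σ ℕ λ r → Σ (Fin r → Vect K) λ w →
                  (∀ k → U (w k)) × Independent allL r w × (∀ t → SL.Span w (x t))
  basisOfSpan {M = zero} x U x∈U = zero , (λ ()) , (λ ()) , (λ _ _ _ ()) , (λ ())
  basisOfSpan {M = suc M} x U x∈U with basisOfSpan (x ∘ suc) U (x∈U ∘ suc)
  ... | r , w , w∈U , w-ind , x∈⟨w⟩ with Span? w (x zero)
  ... | yes x₀∈⟨w⟩ = r , w , w∈U , w-ind , λ { zero → x₀∈⟨w⟩ ; (suc t) → x∈⟨w⟩ t }
  ... | no x₀∉⟨w⟩ = suc r , (x zero ∷ w) , (λ { zero → x∈U zero ; (suc k) → w∈U k })
                  , SL.cons-independent w x₀∉⟨w⟩ w-ind
                  , λ { zero → SL.Span-member (x zero ∷ w) zero ; (suc t) → SL.Span-cons w (x zero) (x∈⟨w⟩ t) }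

  extendIndependent : ∀ {K r n} (w : Fin r → Vect K) → r ≤ n → n ≤ K → Independent allL r w →
                      Σ (Fin n → Vect K) λ w′ → Independent allL n w′ × (∀ {y} → SL.Span w y → SL.Span w′ y)
  extendIndependent {n = zero} w z≤n _ w-ind = w , w-ind , λ y∈ → y∈
  extendIndependent {n = suc n} w r≤1+n 1+n≤K w-ind with ℕP.m≤n⇒m<n∨m≡n r≤1+n
  ... | inj₂ ≡.refl = w , w-ind , λ y∈ → y∈
  ... | inj₁ (s≤s r≤n) with extendIndependent w r≤n (ℕP.<⇒≤ 1+n≤K) w-ind
  ... | w′ , w′-ind , ⟨w⟩⊆⟨w′⟩ with ∃e∉Span w′ 1+n≤K
  ... | k , eₖ∉⟨w′⟩ = (e k ∷ w′) , SL.cons-independent w′ eₖ∉⟨w′⟩ w′-ind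
                    , λ y∈ → SL.Span-cons w′ (e k) (⟨w⟩⊆⟨w′⟩ y∈)

  basis-scaled-independent : ∀ {K} {v : Vect K} → NonZeroV v → Independent inF h (λ j → basis j ·V v)
  basis-scaled-independent {v = v} v≉0 a a∈F a·bv≋0 =
    basis-indep a a∈F (scale≋0⇒≈0 v≉0 λ j → trans (sym (lincomb-scaled h a basis v j)) (a·bv≋0 j))

  -- The F-family b_j w_k of field reduction, block by block in k.
  fieldReduce : ∀ {K} m → (Fin m → Vect K) → Fin (m ℕ.* h) → Vect K
  fieldReduce zero w ()
  fieldReduce (suc m) w = (λ j → basis j ·V w zero) ++ fieldReduce m (w ∘ suc)

  gatherCoefficients : ∀ m → (Fin (m ℕ.* h) → Carrier) → Fin m → Carrier
  gatherCoefficients (suc m) a zero = ∑ h (λ j → a (j ↑ˡ m ℕ.* h) * basis j)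
  gatherCoefficients (suc m) a (suc k) = gatherCoefficients m (a ∘ (h ↑ʳ_)) k

  lincomb-fieldReduce : ∀ {K} m a (w : Fin m → Vect K) →
                        lincomb (m ℕ.* h) a (fieldReduce m w) ≋ lincomb m (gatherCoefficients m a) w
  lincomb-fieldReduce zero a w j = refl
  lincomb-fieldReduce (suc m) a w j =
    trans (lincomb-++ h (m ℕ.* h) a (λ j → basis j ·V w zero) (fieldReduce m (w ∘ suc)) j)
          (+-cong (lincomb-scaled h (a ∘ (_↑ˡ m ℕ.* h)) basis (w zero) j)
                  (lincomb-fieldReduce m (a ∘ (h ↑ʳ_)) (w ∘ suc) j))

  gatherCoefficients≈0 : ∀ m a → (∀ t → inF (a t)) → (∀ k → gatherCoefficients m a k ≈ 0#) → ∀ t → a t ≈ 0#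
  gatherCoefficients≈0 (suc m) a a∈F gathered≈0 = splitAt-elim h (m ℕ.* h) (λ t → a t ≈ 0#)
    (basis-indep (a ∘ (_↑ˡ m ℕ.* h)) (a∈F ∘ (_↑ˡ m ℕ.* h)) (gathered≈0 zero))
    (gatherCoefficients≈0 m (a ∘ (h ↑ʳ_)) (a∈F ∘ (h ↑ʳ_)) (gathered≈0 ∘ suc))

  fieldReduce-independent : ∀ {K} m (w : Fin m → Vect K) → Independent allL m w →
                            Independent inF (m ℕ.* h) (fieldReduce m w)
  fieldReduce-independent m w w-ind a a∈F a·fw≋0 = gatherCoefficients≈0 m a a∈F
    (w-ind (gatherCoefficients m a) (λ _ → lift tt) λ j → trans (sym (lincomb-fieldReduce m a w j)) (a·fw≋0 j))

  Span-fieldReduce : ∀ {K} m (w : Fin m → Vect K) {y} → SL.Span w y → SF.Span (fieldReduce m w) y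
  Span-fieldReduce zero w (a , _ , y≋) = (λ ()) , (λ ()) , y≋
  Span-fieldReduce (suc m) w (a , _ , y≋) with basis-span (a zero)
  ... | α , α∈F , a₀≈ = respects (λ j → sym (y≋ j)) (+∈ head∈ tail∈)
    where
      f = λ j → basis j ·V w zero
      g = fieldReduce m (w ∘ suc)
      open IsSubspace (SF.Span-isSubspace (f ++ g))
      head∈ : SF.Span (f ++ g) (a zero ·V w zero)
      head∈ = SF.Span-mono (SF.Span-++ˡ f g)
                (α , α∈F , λ j → trans (*-congʳ a₀≈) (sym (lincomb-scaled h α basis (w zero) j)))
      tail∈ : SF.Span (f ++ g) (lincomb m (a ∘ suc) (w ∘ suc))
      tail∈ = SF.Span-mono (SF.Span-++ʳ f g) (Span-fieldReduce m (w ∘ suc) (a ∘ suc , (λ _ → lift tt) , λ j → refl))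

module Reduction {c ℓ} {L : Field c ℓ} {q h′ : ℕ} (E : FiniteExtension L q (suc (suc h′)))
                 {K₀ N : ℕ} (P : Fin N → Linear.Vect L (suc K₀)) (P≉0 : ∀ i → Linear.NonZeroV L (P i)) where
  open Field L hiding (zero)
  open Linear L
  open FiniteExtension E
  open Theorem E
  open FiniteExtensionFacts E
  open LinearAlgebra L _≟_

  hyperplane⇒¬avoidance : InSomeHyperplane P → ¬ AvoidanceProperty P
  hyperplane⇒¬avoidance (H , _ , (w , _ , w-ind , w-spans) , P∈H) avoids =
    avoids (SF.Span β , SF.Span-isSubspace β , (β , SF.Span-member β , β-ind , λ _ y∈ → y∈) , Λ∩P)
    where
      u∉⟨w⟩ = ∃e∉Span w (ℕP.n<1+n K₀)
      u = e (proj₁ u∉⟨w⟩)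
      β : Fin (h′ ℕ.+ K₀ ℕ.* suc (suc h′)) → Vect (suc K₀)
      β t = fieldReduce (suc K₀) (u ∷ w) (suc (suc t))
      β-ind : Independent inF (h′ ℕ.+ K₀ ℕ.* suc (suc h′)) β
      β-ind = SF.independent-tail (λ t → uw↓ (suc t)) (SF.independent-tail uw↓
                (fieldReduce-independent (suc K₀) (u ∷ w) (SL.cons-independent w (proj₂ u∉⟨w⟩) w-ind)))
        where uw↓ = fieldReduce (suc K₀) (u ∷ w)
      ⟨w⟩⊆⟨β⟩ : ∀ {y} → SL.Span w y → SF.Span β y
      ⟨w⟩⊆⟨β⟩ y∈ = SF.Span-mono reduced∈ (Span-fieldReduce K₀ w y∈)
        where
          reduced∈ : ∀ t → SF.Span β (fieldReduce K₀ w t)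
          reduced∈ t = IsSubspace.respects (SF.Span-isSubspace β)
            (λ j → reflexive (≡.cong (λ v → v j) (lookup-++ʳ (λ j → basis j ·V u) (fieldReduce K₀ w) t)))
            (SF.Span-member β (h′ ↑ʳ t))
      Λ∩P : ∀ i → DimAtLeast inF (SF.Span β ∩ pt (P i)) (suc h′)
      Λ∩P i = (λ j → basis (suc j) ·V P i)
            , (λ j → ⟨w⟩⊆⟨β⟩ (IsSubspace.·∈ (SL.Span-isSubspace w) (lift tt) (w-spans (P i) (P∈H i)))
                   , basis (suc j) , λ _ → refl)
            , SF.independent-tail (λ j → basis j ·V P i) (basis-scaled-independent (P≉0 i))

  counterexample⇒hyperplane⊎badLinearSet :
    (Λ : VSet (suc K₀)) → IsSubspace inF Λ → HasDim inF Λ (suc K₀ ℕ.* suc (suc h′) ℕ.∸ 2) →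
    (∀ i → DimAtLeast inF (Λ ∩ pt (P i)) (suc h′)) → InSomeHyperplane P ⊎ BadLinearSet P
  counterexample⇒hyperplane⊎badLinearSet Λ Λ-sub Λ-dim@(b , b∈Λ , _ , b-spans) Λ∩P
    with basisOfSpan b Λ b∈Λ
  ... | r , w , w∈Λ , w-ind , b∈⟨w⟩ with ℕP.m≤n⇒m<n∨m≡n (independent⇒≤dim w w-ind)
  ... | inj₂ ≡.refl = inj₂ (Λ , Λ-sub , Λ-dim , Λ-spansAll , Λ∩P)
    where
      Λ-spansAll : LSpansAll Λ
      Λ-spansAll x with Span? w x
      ... | yes (a , _ , x≋) = r , w , w∈Λ , a , x≋
      ... | no x∉⟨w⟩ = ⊥-elim (ℕP.n≮n r (independent⇒≤dim (x ∷ w) (SL.cons-independent w x∉⟨w⟩ w-ind)))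
  ... | inj₁ (s≤s r≤K₀) with extendIndependent w r≤K₀ (ℕP.n≤1+n K₀) w-ind
  ... | w′ , w′-ind , ⟨w⟩⊆⟨w′⟩ =
    inj₁ (SL.Span w′ , SL.Span-isSubspace w′ , (w′ , SL.Span-member w′ , w′-ind , λ _ y∈ → y∈)
         , λ i → ⟨w⟩⊆⟨w′⟩ (P∈⟨w⟩ i))
    where
      Λ⊆⟨w⟩ : ∀ {y} → Λ y → SL.Span w y
      Λ⊆⟨w⟩ y∈Λ with b-spans _ y∈Λ
      ... | a , _ , y≋ = SL.Span-mono b∈⟨w⟩ (a , (λ _ → lift tt) , y≋)
      P∈⟨w⟩ : ∀ i → SL.Span w (P i)
      P∈⟨w⟩ i with Λ∩P i
      ... | z , z∈ , z-ind = pt∩nonzero⇒∈ (SL.Span-isSubspace w) (proj₂ (z∈ zero))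
                               (SF.independent⇒head-nonzero z z-ind) (Λ⊆⟨w⟩ (proj₁ (z∈ zero)))

mainTheorem15 : {c ℓ : Level} (L : Field c ℓ) (q h K N : ℕ) →
    IsPrimePower q → K ≥ 2 → h ≥ 2 →
    (E : FiniteExtension L q h) →
    (P : Fin N → Linear.Vect L K) →
    (∀ i → Linear.NonZeroV L (P i)) →
    (∀ i j → Linear.SamePoint L (P i) (P j) → i ≡ j) →
    Theorem.AvoidanceProperty E P ⇔
    ((¬ Theorem.InSomeHyperplane E P) × (¬ Theorem.BadLinearSet E P))
mainTheorem15 L q (suc (suc h′)) K N _ (s≤s _) (s≤s (s≤s z≤n)) E P P≉0 _ =
  mk⇔ (λ avoids → (λ P⊆H → hyperplane⇒¬avoidance P⊆H avoids)
                 , λ { (V , V-sub , V-dim , _ , V∩P) → avoids (V , V-sub , V-dim , V∩P) })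
      (λ { (¬P⊆H , ¬bad) (Λ , Λ-sub , Λ-dim , Λ∩P) →
             [ ¬P⊆H , ¬bad ] (counterexample⇒hyperplane⊎badLinearSet Λ Λ-sub Λ-dim Λ∩P) })
  where open Reduction E P P≉0
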